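{- Let $k\geq 1$, $s\geq 4k$ and $n\geq 0$ be integers. Then the maximum $N$ such that there exists a $(C_N,s)$-successful (adaptive) strategy with $n$ tests, where the target moves at most $k$ steps after each test, is $$N_c(n,s)=2^n(s-4k)+4k.$$
   Context: Search model: $G$ is a finite graph on vertex set $\{1,\dots,N\}$ with a loop at every vertex. For $\mathcal A\subseteq\{1,\dots,N\}$, $\Gamma_k(\mathcal A)$ is the set of vertices $j$ such that for some $i\in\mathcal A$ there is a path (walk) from $i$ to $j$ in $G$ of length at most $k$. An unknown target occupies a vertex; a searcher performs tests $\mathcal T_1,\dots,\mathcal T_n\subseteq\{1,\dots,N\}$ one after another; test $i$ returns $y_i=1$ if the target currently lies in $\mathcal T_i$ and $y_i=0$ otherwise; after each test the target moves along a walk of length at most $k$. In an (adaptive) strategy, $\mathcal T_i$ may depend on $y_1,\dots,y_{i-1}$. The sets of possible positions are $\mathcal D_0=\{1,\dots,N\}$ and $\mathcal D_i=\Gamma_k(\mathcal T_i\cap\mathcal D_{i-1})$ if $y_i=1$, $\mathcal D_i=\Gamma_k(\mathcal D_{i-1}\setminus\mathcal T_i)$ if $y_i=0$. A strategy with $n$ tests is $(G,s)$-successful if for every sequence of test results, $|\mathcal D_i|\leq s$ for some $i\in\{0,\dots,n\}$. The cycle $C_N$ has vertex set $\{1,\dots,N\}$, edges $\{i,i+1\}$ for $1\leq i<N$, the edge $\{N,1\}$, and a loop at every vertex. $N_c(n,s)$ denotes the maximum $N$ such that a $(C_N,s)$-successful strategy with $n$ tests exists. -}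

module Defs where

open import Data.Nat using (ℕ; zero; suc; _+_; _*_; _∸_; _^_; _≤_; _≡ᵇ_)
open import Data.Bool using (Bool; true; false; _∧_; _∨_)
open import Data.Fin using (Fin; toℕ) renaming (zero to fzero; suc to fsuc)
open import Data.Fin.Subset using (Subset; ∣_∣; _∩_; _─_; ⊤)
open import Data.Vec using (tabulate; lookup)
open import Data.Product using (Σ; _×_; _,_)
open import Data.Sum using (_⊎_)
open import Data.Unit using () renaming (⊤ to Unit)

-- Vertices {1,…,N} are represented by Fin N (vertex i+1 ↔ index i).
-- A graph on Fin N is a boolean adjacency relation (loops included by the user).
Graph : ℕ → Set
Graph N = Fin N → Fin N → Bool

anyFin : {N : ℕ} → (Fin N → Bool) → Bool
anyFin {zero} p = false
anyFin {suc N} p = p fzero ∨ anyFin {N} (λ i → p (fsuc i))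

walkLe : {N : ℕ} → Graph N → ℕ → Fin N → Fin N → Bool
walkLe G zero i j = toℕ i ≡ᵇ toℕ j
walkLe G (suc m) i j = walkLe G m i j ∨ anyFin (λ l → walkLe G m i l ∧ G l j)

Γ : {N : ℕ} → Graph N → ℕ → Subset N → Subset N
Γ G k A = tabulate (λ j → anyFin (λ i → lookup A i ∧ walkLe G k i j))

cycEdge : {N : ℕ} → Fin N → Fin N → Bool
cycEdge {N} i j = (suc (toℕ i) ≡ᵇ toℕ j) ∨ ((suc (toℕ i) ≡ᵇ N) ∧ (toℕ j ≡ᵇ 0))

cycle : (N : ℕ) → Graph N
cycle N i j = (toℕ i ≡ᵇ toℕ j) ∨ cycEdge i j ∨ cycEdge j i

-- Adaptive strategy with n tests: a binary decision tree of depth n whose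
-- nodes are tests; the next test may depend on the result y ∈ Bool.
Strategy : ℕ → ℕ → Set
Strategy N zero = Unit
Strategy N (suc n) = Subset N × (Bool → Strategy N n)

update : {N : ℕ} → Graph N → ℕ → Subset N → Bool → Subset N → Subset N
update G k T true D = Γ G k (T ∩ D)
update G k T false D = Γ G k (D ─ T)

SuccessfulFrom : {N : ℕ} → Graph N → (k s n : ℕ) → Strategy N n → Subset N → Set
SuccessfulFrom G k s zero σ D = ∣ D ∣ ≤ s
SuccessfulFrom G k s (suc n) (T , f) D =
  ∣ D ∣ ≤ s ⊎ ((y : Bool) → SuccessfulFrom G k s n (f y) (update G k T y D))

Successful : {N : ℕ} → Graph N → (k s n : ℕ) → Strategy N n → Set
Successful G k s n σ = SuccessfulFrom G k s n σ ⊤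

CycleSearchable : (k s n N : ℕ) → Set
CycleSearchable k s n N = Σ (Strategy N n) (λ σ → Successful (cycle N) k s n σ)

IsNc : (k s n M : ℕ) → Set
IsNc k s n M = CycleSearchable k s n M × ((N : ℕ) → CycleSearchable k s n N → N ≤ M)

-- On the cycle, the k-neighbourhood of a nonempty set A of vertices has at least
-- min(N, |A| + 2k) elements: unless a set already covers the cycle, one step of the
-- target extends it by a vertex clockwise and by another one counterclockwise.
-- A test splits the possible positions D into two parts, each of which gains 2k
-- vertices before the next test unless it already fills the cycle; hence if n more
-- tests can bring D down to size s, then |D| ≤ Nc n = 2^n (s − 4k) + 4k, using
-- Nc (n+1) = 2 Nc n − 4k.  Conversely, if D lies in an arc of length Nc (n+1),
-- testing the first half of that arc, of length 2^n (s − 4k) + 2k, leaves D inside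
-- an arc of length Nc n after the target has moved, whatever the answer.
module Submission where

open import Defs
open import Data.Nat using (ℕ; zero; suc; pred; _+_; _*_; _∸_; _^_; _≤_; _<_; _<?_; _≡ᵇ_; z≤n; s≤s; NonZero; >-nonZero)
open import Data.Nat.Properties
open import Data.Bool using (Bool; true; false; T; _∧_; _∨_; if_then_else_)
open import Data.Bool.Properties using (T-∧; T-∨; T-≡)
open import Data.Fin using (Fin; toℕ) renaming (zero to fzero; suc to fsuc)
open import Data.Fin.Properties using (toℕ-injective; toℕ<n; toℕ-fromℕ<; any?; all?; ¬∀⟶∃¬)
open import Data.Fin.Subset using (Subset; ∣_∣; _∩_; _─_; _∪_; ⊤; ⊥; ⁅_⁆; _∈_; _∉_; _⊆_; Nonempty; outside; inside)
open import Data.Fin.Subset.Properties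
open import Data.Vec using ([]; _∷_; tabulate; lookup; here; there)
open import Data.Vec.Properties using (lookup∘tabulate; []=⇒lookup; lookup⇒[]=)
open import Data.Product using (_×_; _,_; ∃)
open import Data.Sum using (_⊎_; inj₁; inj₂)
open import Data.Unit using (tt)
open import Function using (_∘_; Equivalence)
open import Relation.Nullary using (¬_; yes; no; contradiction; ¬?; _×-dec_)
open import Data.Nat.DivMod using (_%_; _mod_; m%n<n; %-distribˡ-+; m%n%n≡m%n; m%n≤n; [m+n]%n≡m%n; m<n⇒m%n≡m; n%n≡0)
open import Data.Nat.Tactic.RingSolver using (solve-∀)
open import Relation.Binary.PropositionalEquality

open Equivalence using (to; from)

anyFin⁺ : ∀ {N} (p : Fin N → Bool) i → T (p i) → T (anyFin p)
anyFin⁺ p fzero pi = from T-∨ (inj₁ pi)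
anyFin⁺ p (fsuc i) pi = from (T-∨ {p fzero}) (inj₂ (anyFin⁺ (p ∘ fsuc) i pi))

anyFin⁻ : ∀ {N} (p : Fin N → Bool) → T (anyFin p) → ∃ λ i → T (p i)
anyFin⁻ {suc N} p h with to (T-∨ {p fzero}) h
... | inj₁ p0 = fzero , p0
... | inj₂ rest with anyFin⁻ (p ∘ fsuc) rest
...   | i , pi = fsuc i , pi

∈-tabulate⁺ : ∀ {N} {f : Fin N → Bool} {j} → T (f j) → j ∈ tabulate f
∈-tabulate⁺ {f = f} {j} fj = lookup⇒[]= j _ (trans (lookup∘tabulate f j) (to T-≡ fj))

∈-tabulate⁻ : ∀ {N} {f : Fin N → Bool} {j} → j ∈ tabulate f → T (f j)
∈-tabulate⁻ {f = f} {j} j∈ = from T-≡ (trans (sym (lookup∘tabulate f j)) ([]=⇒lookup j∈))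

x∈p─q⁻ : ∀ {N} (p q : Subset N) {x} → x ∈ p ─ q → x ∈ p × x ∉ q
x∈p─q⁻ (inside ∷ p) (outside ∷ q) here = here , λ ()
x∈p─q⁻ (inside ∷ p) (inside ∷ q) {fzero} ()
x∈p─q⁻ (outside ∷ p) (inside ∷ q) {fzero} ()
x∈p─q⁻ (outside ∷ p) (outside ∷ q) {fzero} ()
x∈p─q⁻ (_ ∷ p) (_ ∷ q) (there x∈) with x∈p─q⁻ p q x∈
... | x∈p , x∉q = there x∈p , x∉q ∘ drop-there

∣p∪q∣≤∣p∣+∣q∣ : ∀ {N} (p q : Subset N) → ∣ p ∪ q ∣ ≤ ∣ p ∣ + ∣ q ∣
∣p∪q∣≤∣p∣+∣q∣ [] [] = z≤n
∣p∪q∣≤∣p∣+∣q∣ (inside ∷ p) (y ∷ q) = s≤s (≤-trans (∣p∪q∣≤∣p∣+∣q∣ p q) (+-monoʳ-≤ ∣ p ∣ (∣p∣≤∣x∷p∣ y q)))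
∣p∪q∣≤∣p∣+∣q∣ (outside ∷ p) (inside ∷ q) = ≤-trans (s≤s (∣p∪q∣≤∣p∣+∣q∣ p q)) (≤-reflexive (sym (+-suc ∣ p ∣ ∣ q ∣)))
∣p∪q∣≤∣p∣+∣q∣ (outside ∷ p) (outside ∷ q) = ∣p∪q∣≤∣p∣+∣q∣ p q

∣q∩p∣+∣p─q∣≡∣p∣ : ∀ {N} (p q : Subset N) → ∣ q ∩ p ∣ + ∣ p ─ q ∣ ≡ ∣ p ∣
∣q∩p∣+∣p─q∣≡∣p∣ [] [] = refl
∣q∩p∣+∣p─q∣≡∣p∣ (inside ∷ p) (inside ∷ q) = cong suc (∣q∩p∣+∣p─q∣≡∣p∣ p q)
∣q∩p∣+∣p─q∣≡∣p∣ (inside ∷ p) (outside ∷ q) = trans (+-suc _ _) (cong suc (∣q∩p∣+∣p─q∣≡∣p∣ p q))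
∣q∩p∣+∣p─q∣≡∣p∣ (outside ∷ p) (inside ∷ q) = ∣q∩p∣+∣p─q∣≡∣p∣ p q
∣q∩p∣+∣p─q∣≡∣p∣ (outside ∷ p) (outside ∷ q) = ∣q∩p∣+∣p─q∣≡∣p∣ p q

p⊆q∧x∈q─p⇒∣p∣<∣q∣ : ∀ {N} {p q : Subset N} {x} → p ⊆ q → x ∈ q → x ∉ p → ∣ p ∣ < ∣ q ∣
p⊆q∧x∈q─p⇒∣p∣<∣q∣ p⊆q x∈q x∉p = p⊂q⇒∣p∣<∣q∣ (p⊆q , _ , x∈q , x∉p)

full⇒n≤∣p∣ : ∀ {N} {p : Subset N} → (∀ x → x ∈ p) → N ≤ ∣ p ∣
full⇒n≤∣p∣ {N} {p} all∈ = subst (_≤ ∣ p ∣) (∣⊤∣≡n N) (p⊆q⇒∣p∣≤∣q∣ {p = ⊤} (λ {x} _ → all∈ x))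

full-or-missing : ∀ {N} (p : Subset N) → (∀ x → x ∈ p) ⊎ ∃ λ x → x ∉ p
full-or-missing p with all? (_∈? p)
... | yes full = inj₁ full
... | no ¬full = inj₂ (¬∀⟶∃¬ _ (_∈ p) (_∈? p) ¬full)

empty⇒∣p∣≡0 : ∀ {N} {p : Subset N} → ¬ Nonempty p → ∣ p ∣ ≡ 0
empty⇒∣p∣≡0 {N} empty = trans (cong ∣_∣ (Empty-unique empty)) (∣⊥∣≡0 N)

module _ {N : ℕ} (G : Graph N) where

  walkLe-refl : ∀ m i → T (walkLe G m i i)
  walkLe-refl zero i = ≡⇒≡ᵇ (toℕ i) (toℕ i) refl
  walkLe-refl (suc m) i = from T-∨ (inj₁ (walkLe-refl m i))

  walkLe-suc : ∀ m {i j} → T (walkLe G m i j) → T (walkLe G (suc m) i j)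
  walkLe-suc m w = from T-∨ (inj₁ w)

  walkLe-snoc : ∀ m {i l j} → T (walkLe G m i l) → T (G l j) → T (walkLe G (suc m) i j)
  walkLe-snoc m {i} {l} {j} w e =
    from (T-∨ {walkLe G m i j}) (inj₂ (anyFin⁺ (λ l′ → walkLe G m i l′ ∧ G l′ j) l (from T-∧ (w , e))))

  walkLe-zero⁻ : ∀ {i j} → T (walkLe G 0 i j) → i ≡ j
  walkLe-zero⁻ {i} {j} w = toℕ-injective (≡ᵇ⇒≡ (toℕ i) (toℕ j) w)

  walkLe-suc⁻ : ∀ m {i j} → T (walkLe G (suc m) i j) →
                T (walkLe G m i j) ⊎ ∃ λ l → T (walkLe G m i l) × T (G l j)
  walkLe-suc⁻ m {i} {j} w with to (T-∨ {walkLe G m i j}) w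
  ... | inj₁ w′ = inj₁ w′
  ... | inj₂ step with anyFin⁻ _ step
  ...   | l , wl = inj₂ (l , to T-∧ wl)

  ∈Γ⁺ : ∀ m {A i j} → i ∈ A → T (walkLe G m i j) → j ∈ Γ G m A
  ∈Γ⁺ m {A} {i} {j} i∈A w =
    ∈-tabulate⁺ (anyFin⁺ (λ i′ → lookup A i′ ∧ walkLe G m i′ j) i (from T-∧ (from T-≡ ([]=⇒lookup i∈A) , w)))

  ∈Γ⁻ : ∀ m {A j} → j ∈ Γ G m A → ∃ λ i → i ∈ A × T (walkLe G m i j)
  ∈Γ⁻ m {A} j∈ with anyFin⁻ _ (∈-tabulate⁻ j∈)
  ... | i , h with to T-∧ h
  ...   | Ai , w = i , lookup⇒[]= i A (to T-≡ Ai) , w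

  p⊆Γp : ∀ m {A} → A ⊆ Γ G m A
  p⊆Γp m {_} {x} x∈A = ∈Γ⁺ m x∈A (walkLe-refl m x)

  ∣p∣≤∣Γp∣ : ∀ m A → ∣ A ∣ ≤ ∣ Γ G m A ∣
  ∣p∣≤∣Γp∣ m A = p⊆q⇒∣p∣≤∣q∣ (p⊆Γp m {A})

  Γ-suc : ∀ m {A} → Γ G m A ⊆ Γ G (suc m) A
  Γ-suc m {A} x∈ with ∈Γ⁻ m {A} x∈
  ... | i , i∈A , w = ∈Γ⁺ (suc m) i∈A (walkLe-suc m w)

  Γ-snoc : ∀ m {A x y} → x ∈ Γ G m A → T (G x y) → y ∈ Γ G (suc m) A
  Γ-snoc m {A} x∈ e with ∈Γ⁻ m {A} x∈
  ... | i , i∈A , w = ∈Γ⁺ (suc m) i∈A (walkLe-snoc m w e)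

split-bound : ∀ {x y d n b K} → x + y ≡ d → d ≤ n → x ≤ b → y ≤ b →
              x ≡ 0 ⊎ n ≤ b ⊎ x + K ≤ b → y ≡ 0 ⊎ n ≤ b ⊎ y + K ≤ b →
              d ≤ b ⊎ d + (K + K) ≤ b + b
split-bound refl _ x≤b y≤b (inj₁ refl) _ = inj₁ y≤b
split-bound {x} refl _ x≤b y≤b _ (inj₁ refl) = inj₁ (subst (_≤ _) (sym (+-identityʳ x)) x≤b)
split-bound refl d≤n _ _ (inj₂ (inj₁ n≤b)) _ = inj₁ (≤-trans d≤n n≤b)
split-bound refl d≤n _ _ _ (inj₂ (inj₁ n≤b)) = inj₁ (≤-trans d≤n n≤b)
split-bound {x} {y} {b = b} {K} refl _ _ _ (inj₂ (inj₂ x+K≤b)) (inj₂ (inj₂ y+K≤b)) =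
  inj₂ (subst (_≤ b + b) (lemma x y K) (+-mono-≤ x+K≤b y+K≤b))
  where
  lemma : ∀ x y K → x + K + (y + K) ≡ x + y + (K + K)
  lemma = solve-∀

module Cycle (N : ℕ) .{{_ : NonZero N}} where

  -- Vertices are addressed by natural-number positions read modulo N, so that arcs
  -- may wrap around the cycle.
  pt : ℕ → Fin N
  pt x = x mod N

  toℕ-pt : ∀ x → toℕ (pt x) ≡ x % N
  toℕ-pt x = toℕ-fromℕ< (m%n<n x N)

  pt-cong : ∀ {x y} → x % N ≡ y % N → pt x ≡ pt y
  pt-cong {x} {y} e = toℕ-injective (trans (toℕ-pt x) (trans e (sym (toℕ-pt y))))

  pt-toℕ : ∀ j → pt (toℕ j) ≡ j
  pt-toℕ j = toℕ-injective (trans (toℕ-pt (toℕ j)) (m<n⇒m%n≡m (toℕ<n j)))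

  pt-+N : ∀ x → pt (x + N) ≡ pt x
  pt-+N x = pt-cong ([m+n]%n≡m%n x N)

  pt-+% : ∀ x y → pt (x + y % N) ≡ pt (x + y)
  pt-+% x y = pt-cong (begin
    (x + y % N) % N         ≡⟨ %-distribˡ-+ x (y % N) N ⟩
    (x % N + y % N % N) % N ≡⟨ cong (λ z → (x % N + z) % N) (m%n%n≡m%n y N) ⟩
    (x % N + y % N) % N     ≡⟨ %-distribˡ-+ x y N ⟨
    (x + y) % N             ∎)
    where open ≡-Reasoning

  pt-%+ : ∀ x y → pt (x % N + y) ≡ pt (x + y)
  pt-%+ x y = trans (cong pt (+-comm (x % N) y)) (trans (pt-+% y x) (cong pt (+-comm y x)))

  orbit : ∀ a j → ∃ λ t → t < N × pt (a + t) ≡ j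
  orbit a j = z % N , m%n<n z N , (begin
    pt (a + z % N)          ≡⟨ pt-+% a z ⟩
    pt (a + z)              ≡⟨ cong pt (+-comm a z) ⟩
    pt (z + a)              ≡⟨ pt-+% z a ⟨
    pt (z + a % N)          ≡⟨ cong pt (+-assoc (toℕ j) (N ∸ a % N) (a % N)) ⟩
    pt (toℕ j + (N ∸ a % N + a % N)) ≡⟨ cong (λ w → pt (toℕ j + w)) (m∸n+n≡m (m%n≤n a N)) ⟩
    pt (toℕ j + N)          ≡⟨ pt-+N (toℕ j) ⟩
    pt (toℕ j)              ≡⟨ pt-toℕ j ⟩
    j                       ∎)
    where
    open ≡-Reasoning
    z = toℕ j + (N ∸ a % N)

  nxt : Fin N → Fin N
  nxt i = pt (suc (toℕ i))

  nxt-pt : ∀ x → nxt (pt x) ≡ pt (suc x)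
  nxt-pt x = trans (cong (λ y → pt (suc y)) (toℕ-pt x)) (pt-+% 1 x)

  nxt-injective : ∀ {i j} → nxt i ≡ nxt j → i ≡ j
  nxt-injective {i} {j} e = trans (sym (back i)) (trans (cong (λ x → pt (toℕ x + pred N)) e) (back j))
    where
    back : ∀ i → pt (toℕ (nxt i) + pred N) ≡ i
    back i = begin
      pt (toℕ (nxt i) + pred N)       ≡⟨ cong (λ x → pt (x + pred N)) (toℕ-pt (suc (toℕ i))) ⟩
      pt (suc (toℕ i) % N + pred N)   ≡⟨ pt-%+ (suc (toℕ i)) (pred N) ⟩
      pt (suc (toℕ i) + pred N)       ≡⟨ cong pt (sym (+-suc (toℕ i) (pred N))) ⟩
      pt (toℕ i + suc (pred N))       ≡⟨ cong (λ x → pt (toℕ i + x)) (suc-pred N) ⟩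
      pt (toℕ i + N)                  ≡⟨ pt-+N (toℕ i) ⟩
      pt (toℕ i)                      ≡⟨ pt-toℕ i ⟩
      i                               ∎
      where open ≡-Reasoning

  cycEdge-nxt : ∀ i → T (cycEdge i (nxt i))
  cycEdge-nxt i with m≤n⇒m<n∨m≡n (toℕ<n i)
  ... | inj₁ 1+i<N = from T-∨ (inj₁ (≡⇒≡ᵇ _ _ (sym (trans (toℕ-pt _) (m<n⇒m%n≡m 1+i<N)))))
  ... | inj₂ 1+i≡N = from (T-∨ {suc (toℕ i) ≡ᵇ toℕ (nxt i)})
    (inj₂ (from T-∧ (≡⇒≡ᵇ _ _ 1+i≡N , ≡⇒≡ᵇ _ 0 (trans (toℕ-pt _) (trans (cong (_% N) 1+i≡N) (n%n≡0 N))))))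

  cycEdge⁻ : ∀ {i j} → T (cycEdge i j) → j ≡ nxt i
  cycEdge⁻ {i} {j} e with to (T-∨ {suc (toℕ i) ≡ᵇ toℕ j}) e
  ... | inj₁ succ = trans (sym (pt-toℕ j)) (cong pt (sym (≡ᵇ⇒≡ _ _ succ)))
  ... | inj₂ wrap with to (T-∧ {suc (toℕ i) ≡ᵇ N}) wrap
  ...   | last , first = begin
    j                 ≡⟨ pt-toℕ j ⟨
    pt (toℕ j)        ≡⟨ cong pt (≡ᵇ⇒≡ _ 0 first) ⟩
    pt 0              ≡⟨ pt-+N 0 ⟨
    pt N              ≡⟨ cong pt (≡ᵇ⇒≡ _ _ last) ⟨
    nxt i             ∎
    where open ≡-Reasoning

  cycle-nxt : ∀ i → T (cycle N i (nxt i))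
  cycle-nxt i = from (T-∨ {toℕ i ≡ᵇ toℕ (nxt i)}) (inj₂ (from T-∨ (inj₁ (cycEdge-nxt i))))

  cycle-nxt⁻¹ : ∀ i → T (cycle N (nxt i) i)
  cycle-nxt⁻¹ i = from (T-∨ {toℕ (nxt i) ≡ᵇ toℕ i}) (inj₂ (from (T-∨ {cycEdge (nxt i) i}) (inj₂ (cycEdge-nxt i))))

  cycle⁻ : ∀ {l j} → T (cycle N l j) → j ≡ l ⊎ j ≡ nxt l ⊎ l ≡ nxt j
  cycle⁻ {l} {j} e with to (T-∨ {toℕ l ≡ᵇ toℕ j}) e
  ... | inj₁ same = inj₁ (toℕ-injective (sym (≡ᵇ⇒≡ _ _ same)))
  ... | inj₂ e′ with to (T-∨ {cycEdge l j}) e′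
  ...   | inj₁ forward = inj₂ (inj₁ (cycEdge⁻ forward))
  ...   | inj₂ backward = inj₂ (inj₂ (cycEdge⁻ backward))

  nxt-closed⇒full : ∀ {P : Subset N} {a} → a ∈ P → (∀ {x} → x ∈ P → nxt x ∈ P) → ∀ j → j ∈ P
  nxt-closed⇒full {P} {a} a∈P closed j with orbit (toℕ a) j
  ... | t , _ , reaches-j = subst (_∈ P) reaches-j (reach t)
    where
    reach : ∀ t → pt (toℕ a + t) ∈ P
    reach zero = subst (_∈ P) (sym (trans (cong pt (+-identityʳ _)) (pt-toℕ a))) a∈P
    reach (suc t) = subst (_∈ P) (trans (nxt-pt _) (cong pt (sym (+-suc _ t)))) (closed (reach t))

  exit : ∀ {P : Subset N} {a b} → a ∈ P → b ∉ P → ∃ λ i → i ∈ P × nxt i ∉ P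
  exit {P} a∈P b∉P with any? (λ i → i ∈? P ×-dec ¬? (nxt i ∈? P))
  ... | yes found = found
  ... | no none = contradiction (nxt-closed⇒full a∈P closed _) b∉P
    where
    closed : ∀ {x} → x ∈ P → nxt x ∈ P
    closed {x} x∈P with nxt x ∈? P
    ... | yes nx∈P = nx∈P
    ... | no nx∉P = contradiction (x , x∈P , nx∉P) none

  entry : ∀ {P : Subset N} {a b} → a ∈ P → b ∉ P → ∃ λ i → i ∉ P × nxt i ∈ P
  entry a∈P b∉P with exit (x∉p⇒x∈∁p b∉P) (x∈p⇒x∉∁p a∈P)
  ... | i , i∈∁P , nxt-i∉∁P = i , x∈∁p⇒x∉p i∈∁P , x∉∁p⇒x∈p nxt-i∉∁P

  grow-by-two : ∀ {X Z : Subset N} {a} → a ∈ X → X ⊆ Z →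
                (∀ {i} → i ∈ X → nxt i ∈ Z) → (∀ {i} → nxt i ∈ X → i ∈ Z) →
                N ≤ ∣ Z ∣ ⊎ 2 + ∣ X ∣ ≤ ∣ Z ∣
  grow-by-two {X} {Z} a∈X X⊆Z fwd bwd with full-or-missing X
  ... | inj₁ X-full = inj₁ (full⇒n≤∣p∣ (X⊆Z ∘ X-full))
  ... | inj₂ (_ , b∉X) with exit a∈X b∉X
  ...   | i , i∈X , nxt-i∉X = grow-again (full-or-missing Y)
    where
    Y = X ∪ ⁅ nxt i ⁆

    Y⊆Z : Y ⊆ Z
    Y⊆Z y∈Y with x∈p∪q⁻ X ⁅ nxt i ⁆ y∈Y
    ... | inj₁ y∈X = X⊆Z y∈X
    ... | inj₂ y∈⁅nxt-i⁆ = subst (_∈ Z) (sym (x∈⁅y⁆⇒x≡y _ y∈⁅nxt-i⁆)) (fwd i∈X)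

    X<Y : ∣ X ∣ < ∣ Y ∣
    X<Y = p⊆q∧x∈q─p⇒∣p∣<∣q∣ (p⊆p∪q ⁅ nxt i ⁆) (q⊆p∪q X ⁅ nxt i ⁆ (x∈⁅x⁆ (nxt i))) nxt-i∉X

    -- The only new point of Y is nxt i, whose predecessor i already lies in Y.
    entry⇒∈Z : ∀ {i′} → i′ ∉ Y → nxt i′ ∈ Y → i′ ∈ Z
    entry⇒∈Z {i′} i′∉Y nxt-i′∈Y with x∈p∪q⁻ X ⁅ nxt i ⁆ nxt-i′∈Y
    ... | inj₁ nxt-i′∈X = bwd nxt-i′∈X
    ... | inj₂ nxt-i′∈⁅nxt-i⁆ =
      contradiction (subst (_∈ Y) (sym (nxt-injective (x∈⁅y⁆⇒x≡y _ nxt-i′∈⁅nxt-i⁆))) (p⊆p∪q ⁅ nxt i ⁆ i∈X)) i′∉Y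

    grow-again : (∀ y → y ∈ Y) ⊎ (∃ λ y → y ∉ Y) → N ≤ ∣ Z ∣ ⊎ 2 + ∣ X ∣ ≤ ∣ Z ∣
    grow-again (inj₁ Y-full) = inj₁ (full⇒n≤∣p∣ (Y⊆Z ∘ Y-full))
    grow-again (inj₂ (_ , c∉Y)) with entry (p⊆p∪q ⁅ nxt i ⁆ i∈X) c∉Y
    ... | i′ , i′∉Y , nxt-i′∈Y = inj₂ (≤-trans (s≤s X<Y) (p⊆q∧x∈q─p⇒∣p∣<∣q∣ Y⊆Z (entry⇒∈Z i′∉Y nxt-i′∈Y) i′∉Y))

  Γ-nxt : ∀ m {A i} → i ∈ Γ (cycle N) m A → nxt i ∈ Γ (cycle N) (suc m) A
  Γ-nxt m {A} {i} i∈ = Γ-snoc (cycle N) m {A} i∈ (cycle-nxt i)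

  Γ-nxt⁻¹ : ∀ m {A i} → nxt i ∈ Γ (cycle N) m A → i ∈ Γ (cycle N) (suc m) A
  Γ-nxt⁻¹ m {A} {i} nxt-i∈ = Γ-snoc (cycle N) m {A} nxt-i∈ (cycle-nxt⁻¹ i)

  Γ-expand : ∀ {A : Subset N} {a} → a ∈ A → ∀ m →
             N ≤ ∣ Γ (cycle N) m A ∣ ⊎ ∣ A ∣ + 2 * m ≤ ∣ Γ (cycle N) m A ∣
  Γ-expand {A} a∈A zero = inj₂ (≤-trans (≤-reflexive (+-identityʳ ∣ A ∣)) (∣p∣≤∣Γp∣ (cycle N) 0 A))
  Γ-expand {A} a∈A (suc m)
    with Γ-expand a∈A m | grow-by-two (p⊆Γp (cycle N) m {A} a∈A) (Γ-suc (cycle N) m {A}) (Γ-nxt m {A}) (Γ-nxt⁻¹ m {A})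
  ... | inj₁ full | _ = inj₁ (≤-trans full (p⊆q⇒∣p∣≤∣q∣ (Γ-suc (cycle N) m {A})))
  ... | inj₂ _ | inj₁ full = inj₁ full
  ... | inj₂ grown | inj₂ grown′ = inj₂ (≤-trans (≤-reflexive (+-2*-suc ∣ A ∣ m)) (≤-trans (s≤s (s≤s grown)) grown′))
    where
    +-2*-suc : ∀ x m → x + 2 * suc m ≡ 2 + (x + 2 * m)
    +-2*-suc = solve-∀

  Γ-bound : ∀ m {b} (X : Subset N) → ∣ Γ (cycle N) m X ∣ ≤ b → ∣ X ∣ ≡ 0 ⊎ N ≤ b ⊎ ∣ X ∣ + 2 * m ≤ b
  Γ-bound m X ∣ΓX∣≤b with nonempty? X
  ... | no empty = inj₁ (empty⇒∣p∣≡0 empty)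
  ... | yes (_ , a∈X) with Γ-expand a∈X m
  ...   | inj₁ full = inj₂ (inj₁ (≤-trans full ∣ΓX∣≤b))
  ...   | inj₂ grown = inj₂ (inj₂ (≤-trans grown ∣ΓX∣≤b))

  test-bound : ∀ m {b} (T D : Subset N) → (∀ y → ∣ update (cycle N) m T y D ∣ ≤ b) →
               ∣ D ∣ ≤ b ⊎ ∣ D ∣ + (2 * m + 2 * m) ≤ b + b
  test-bound m T D bounded =
    split-bound (∣q∩p∣+∣p─q∣≡∣p∣ D T) (∣p∣≤n D)
                (≤-trans (∣p∣≤∣Γp∣ (cycle N) m (T ∩ D)) (bounded true)) (≤-trans (∣p∣≤∣Γp∣ (cycle N) m (D ─ T)) (bounded false))
                (Γ-bound m (T ∩ D) (bounded true)) (Γ-bound m (D ─ T) (bounded false))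

  -- The start is offset by m so that stepping backwards needs no truncated subtraction.
  walk-displacement : ∀ m b {j} → T (walkLe (cycle N) m (pt (b + m)) j) → ∃ λ e → e ≤ 2 * m × j ≡ pt (b + e)
  walk-displacement zero b w = 0 , z≤n , sym (walkLe-zero⁻ (cycle N) w)
  walk-displacement (suc m) b {j} w = extend (walkLe-suc⁻ (cycle N) m (subst start (cong pt (+-suc b m)) w))
    where
    start : Fin N → Set
    start i = T (walkLe (cycle N) (suc m) i j)

    bound : ∀ {e} d → d ≤ 2 → e ≤ 2 * m → d + e ≤ 2 * suc m
    bound d d≤2 e≤ = ≤-trans (+-mono-≤ d≤2 e≤) (≤-reflexive (sym (*-suc 2 m)))

    shift : ∀ e → pt (suc b + e) ≡ pt (b + suc e)
    shift e = cong pt (sym (+-suc b e))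

    extend : T (walkLe (cycle N) m (pt (suc b + m)) j) ⊎ ∃ (λ l → T (walkLe (cycle N) m (pt (suc b + m)) l) × T (cycle N l j)) →
             ∃ λ e → e ≤ 2 * suc m × j ≡ pt (b + e)
    extend (inj₁ w′) with walk-displacement m (suc b) w′
    ... | e , e≤ , j≡ = 1 + e , bound 1 (s≤s z≤n) e≤ , trans j≡ (shift e)
    extend (inj₂ (l , w′ , edge)) with walk-displacement m (suc b) w′ | cycle⁻ edge
    ... | e , e≤ , l≡ | inj₁ j≡l = 1 + e , bound 1 (s≤s z≤n) e≤ , trans j≡l (trans l≡ (shift e))
    ... | e , e≤ , l≡ | inj₂ (inj₁ j≡nxt-l) = 2 + e , bound 2 ≤-refl e≤ , (begin
      j                      ≡⟨ j≡nxt-l ⟩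
      nxt l                  ≡⟨ cong nxt l≡ ⟩
      nxt (pt (suc b + e))   ≡⟨ nxt-pt (suc b + e) ⟩
      pt (suc (suc b + e))   ≡⟨ cong (pt ∘ suc) (sym (+-suc b e)) ⟩
      pt (suc (b + suc e))   ≡⟨ shift (suc e) ⟩
      pt (b + suc (suc e))   ∎)
      where open ≡-Reasoning
    ... | e , e≤ , l≡ | inj₂ (inj₂ l≡nxt-j) =
      0 + e , bound 0 z≤n e≤ , nxt-injective (trans (sym l≡nxt-j) (trans l≡ (sym (nxt-pt (b + e)))))

  arc : ℕ → ℕ → Subset N
  arc a zero = ⊥
  arc a (suc L) = arc a L ∪ ⁅ pt (a + L) ⁆

  ∣arc∣≤ : ∀ a L → ∣ arc a L ∣ ≤ L
  ∣arc∣≤ a zero = ≤-reflexive (∣⊥∣≡0 N)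
  ∣arc∣≤ a (suc L) = begin
    ∣ arc a L ∪ ⁅ pt (a + L) ⁆ ∣       ≤⟨ ∣p∪q∣≤∣p∣+∣q∣ (arc a L) ⁅ pt (a + L) ⁆ ⟩
    ∣ arc a L ∣ + ∣ ⁅ pt (a + L) ⁆ ∣   ≤⟨ +-mono-≤ (∣arc∣≤ a L) (≤-reflexive (∣⁅x⁆∣≡1 (pt (a + L)))) ⟩
    L + 1                              ≡⟨ +-comm L 1 ⟩
    suc L                              ∎
    where open ≤-Reasoning

  ∈arc⁺ : ∀ a {L t} → t < L → pt (a + t) ∈ arc a L
  ∈arc⁺ a {suc L} t<1+L with m<1+n⇒m<n∨m≡n t<1+L
  ... | inj₁ t<L = p⊆p∪q ⁅ pt (a + L) ⁆ (∈arc⁺ a t<L)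
  ... | inj₂ refl = q⊆p∪q (arc a L) ⁅ pt (a + L) ⁆ (x∈⁅x⁆ (pt (a + L)))

  ∈arc⁻ : ∀ a L {j} → j ∈ arc a L → ∃ λ t → t < L × j ≡ pt (a + t)
  ∈arc⁻ a zero j∈ = contradiction j∈ ∉⊥
  ∈arc⁻ a (suc L) j∈ with x∈p∪q⁻ (arc a L) ⁅ pt (a + L) ⁆ j∈
  ... | inj₁ j∈arc with ∈arc⁻ a L j∈arc
  ...   | t , t<L , j≡ = t , m<n⇒m<1+n t<L , j≡
  ∈arc⁻ a (suc L) j∈ | inj₂ j∈⁅⁆ = L , ≤-refl , x∈⁅y⁆⇒x≡y _ j∈⁅⁆

  arc-full : ∀ a → ⊤ ⊆ arc a N
  arc-full a {j} _ with orbit a j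
  ... | t , t<N , reaches-j = subst (_∈ arc a N) reaches-j (∈arc⁺ a t<N)

  Γ-arc : ∀ m b L {D} → D ⊆ arc (b + m) L → Γ (cycle N) m D ⊆ arc b (L + 2 * m)
  Γ-arc m b L {D} D⊆arc {j} j∈ with ∈Γ⁻ (cycle N) m {D} j∈
  ... | i , i∈D , w with ∈arc⁻ (b + m) L (D⊆arc i∈D)
  ...   | t , t<L , refl = shifted (walk-displacement m (b + t) (subst (λ i → T (walkLe (cycle N) m i j)) (cong pt (+-shuffle b m t)) w))
    where
    +-shuffle : ∀ b m t → b + m + t ≡ b + t + m
    +-shuffle = solve-∀

    shifted : (∃ λ e → e ≤ 2 * m × j ≡ pt (b + t + e)) → j ∈ arc b (L + 2 * m)
    shifted (e , e≤ , j≡) = subst (_∈ arc b (L + 2 * m)) (sym (trans j≡ (cong pt (+-assoc b t e)))) (∈arc⁺ b (+-mono-<-≤ t<L e≤))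

  arc-─ : ∀ a p q {D} → D ⊆ arc a (p + q) → D ─ arc a p ⊆ arc (a + p) q
  arc-─ a p q {D} D⊆arc j∈ with x∈p─q⁻ D (arc a p) j∈
  ... | j∈D , j∉arc with ∈arc⁻ a (p + q) (D⊆arc j∈D)
  ...   | t , t<p+q , refl with t <? p
  ...     | yes t<p = contradiction (∈arc⁺ a t<p) j∉arc
  ...     | no t≮p = subst (_∈ arc (a + p) q) (cong pt (trans (+-assoc a p (t ∸ p)) (cong (a +_) p+[t∸p]≡t)))
                       (∈arc⁺ (a + p) (+-cancelˡ-< p _ _ (subst (_< p + q) (sym p+[t∸p]≡t) t<p+q)))
    where
    p+[t∸p]≡t : p + (t ∸ p) ≡ t
    p+[t∸p]≡t = m+[n∸m]≡n (≮⇒≥ t≮p)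

module Search (N : ℕ) .{{_ : NonZero N}} (k c s : ℕ) where

  open Cycle N

  testLength : ℕ → ℕ
  testLength m = 2 ^ m * c + 2 * k

  arcLength : ℕ → ℕ
  arcLength m = testLength m + 2 * k

  arcLength≡ : ∀ m → arcLength m ≡ 2 ^ m * c + 4 * k
  arcLength≡ m = lemma (2 ^ m) c k
    where
    lemma : ∀ p c k → p * c + 2 * k + 2 * k ≡ p * c + 4 * k
    lemma = solve-∀

  -- With m tests left, the target is known to lie in arc (x + m * k) (arcLength m).
  strategy : ∀ m → ℕ → Strategy N m
  strategy zero x = tt
  strategy (suc m) x = arc (x + suc m * k) (testLength m) , λ y → strategy m (if y then x else x + testLength m)

  strategy-successful : arcLength 0 ≤ s → ∀ m x {D} → D ⊆ arc (x + m * k) (arcLength m) →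
                        SuccessfulFrom (cycle N) k s m (strategy m x) D
  strategy-successful L₀≤s zero x {D} D⊆arc = ≤-trans (p⊆q⇒∣p∣≤∣q∣ D⊆arc) (≤-trans (∣arc∣≤ _ (arcLength 0)) L₀≤s)
  strategy-successful L₀≤s (suc m) x {D} D⊆arc = inj₂ λ where
      true → strategy-successful L₀≤s m x
               (Γ-arc k (x + m * k) h (⊆-trans (p∩q⊆p test D) (⊆-reflexive (cong (λ a → arc a h) start-true))))
      false → strategy-successful L₀≤s m (x + h)
               (Γ-arc k (x + h + m * k) h (⊆-trans (arc-─ a h h D⊆halves) (⊆-reflexive (cong (λ a → arc a h) start-false))))
    where
    h = testLength m
    a = x + suc m * k
    test = arc a h

    start-true : a ≡ x + m * k + k
    start-true = lemma x m k
      where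
      lemma : ∀ x m k → x + suc m * k ≡ x + m * k + k
      lemma = solve-∀

    start-false : a + h ≡ x + h + m * k + k
    start-false = lemma x m k h
      where
      lemma : ∀ x m k h → x + suc m * k + h ≡ x + h + m * k + k
      lemma = solve-∀

    D⊆halves : D ⊆ arc a (h + h)
    D⊆halves = ⊆-trans D⊆arc (⊆-reflexive (cong (arc a) (lemma (2 ^ m) c k)))
      where
      lemma : ∀ p c k → 2 * p * c + 2 * k + 2 * k ≡ p * c + 2 * k + (p * c + 2 * k)
      lemma = solve-∀

module Bound (k s : ℕ) (4k≤s : 4 * k ≤ s) where

  Nc : ℕ → ℕ
  Nc m = 2 ^ m * (s ∸ 4 * k) + 4 * k

  Nc-zero : Nc 0 ≡ s
  Nc-zero = trans (cong (_+ 4 * k) (*-identityˡ (s ∸ 4 * k))) (m∸n+n≡m 4k≤s)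

  Nc-mono : ∀ {m m′} → m ≤ m′ → Nc m ≤ Nc m′
  Nc-mono m≤m′ = +-monoˡ-≤ (4 * k) (*-monoˡ-≤ (s ∸ 4 * k) (^-monoʳ-≤ 2 m≤m′))

  Nc-suc : ∀ m → Nc m + Nc m ≡ Nc (suc m) + (2 * k + 2 * k)
  Nc-suc m = lemma (2 ^ m) (s ∸ 4 * k) k
    where
    lemma : ∀ p c k → p * c + 4 * k + (p * c + 4 * k) ≡ 2 * p * c + 4 * k + (2 * k + 2 * k)
    lemma = solve-∀

  successful⇒∣D∣≤Nc : ∀ {N} m σ (D : Subset N) → SuccessfulFrom (cycle N) k s m σ D → ∣ D ∣ ≤ Nc m
  successful⇒∣D∣≤Nc {zero} m σ D _ = ≤-trans (∣p∣≤n D) z≤n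
  successful⇒∣D∣≤Nc {suc _} zero σ D ∣D∣≤s = subst (∣ D ∣ ≤_) (sym Nc-zero) ∣D∣≤s
  successful⇒∣D∣≤Nc {suc _} (suc m) σ D (inj₁ ∣D∣≤s) = ≤-trans ∣D∣≤s (subst (_≤ Nc (suc m)) Nc-zero (Nc-mono {0} {suc m} z≤n))
  successful⇒∣D∣≤Nc {suc N} (suc m) (T , next) D (inj₂ successful)
    with Cycle.test-bound (suc N) k T D (λ y → successful⇒∣D∣≤Nc m (next y) _ (successful y))
  ... | inj₁ ∣D∣≤Nc = ≤-trans ∣D∣≤Nc (Nc-mono (n≤1+n m))
  ... | inj₂ doubled = +-cancelʳ-≤ (2 * k + 2 * k) _ _ (subst (∣ D ∣ + (2 * k + 2 * k) ≤_) (Nc-suc m) doubled)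

  searchable⇒≤Nc : ∀ n N → CycleSearchable k s n N → N ≤ Nc n
  searchable⇒≤Nc n N (σ , successful) = subst (_≤ Nc n) (∣⊤∣≡n N) (successful⇒∣D∣≤Nc n σ ⊤ successful)

  Nc-searchable : 1 ≤ k → ∀ n → CycleSearchable k s n (Nc n)
  Nc-searchable 1≤k n = strategy n 0 , strategy-successful (≤-reflexive (trans (arcLength≡ 0) Nc-zero)) n 0 ⊤⊆arc
    where
    Nc-nonZero : NonZero (Nc n)
    Nc-nonZero = >-nonZero (≤-trans 1≤k (≤-trans (m≤n*m k 4) (m≤n+m (4 * k) (2 ^ n * (s ∸ 4 * k)))))

    open Search (Nc n) {{Nc-nonZero}} k (s ∸ 4 * k) s
    open Cycle (Nc n) {{Nc-nonZero}} using (arc; arc-full)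

    ⊤⊆arc : ⊤ ⊆ arc (0 + n * k) (arcLength n)
    ⊤⊆arc = ⊆-trans (arc-full _) (⊆-reflexive (cong (arc _) (sym (arcLength≡ n))))

theorem1 : (k s n : ℕ) → 1 ≤ k → 4 * k ≤ s → IsNc k s n (2 ^ n * (s ∸ 4 * k) + 4 * k)
theorem1 k s n 1≤k 4k≤s = Nc-searchable 1≤k n , searchable⇒≤Nc n
  where open Bound k s 4k≤s
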